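{- Let $(\Gamma,N)$ be a numbered graph with standard generating set $S$ of $\mathrm{NGP}(\Gamma,N)$. Consider the finite state automaton $\mathcal{D}$ over the alphabet $S$ whose states are the powered cliques of $(\Gamma,N)$ (all of which are accept states) together with one reject state $q_{\mathrm{rej}}$ (absorbing: every letter sends it to itself), whose start state is the empty powered clique, and whose transition map $\delta$ is: for $v\in V\Gamma$ and a powered clique $\Sigma$ with $0\le\Sigma(v)<\lfloor N(v)/2\rfloor$, $\delta(\Sigma,v)$ is the powered clique with support $(\mathrm{supp}\,\Sigma\cap\mathrm{Lk}(v))\cup\{v\}$ and powers $\delta(\Sigma,v)(u)=\Sigma(u)$ for $u\in\mathrm{Lk}(v)$, $\delta(\Sigma,v)(v)=\Sigma(v)+1$ (and $0$ elsewhere); for $v$ with $N(v)\ne2$ and $\Sigma$ with $-\lfloor N(v)/2\rfloor<\Sigma(v)\le0$, $\delta(\Sigma,v^{ -1})$ is the powered clique with support $(\mathrm{supp}\,\Sigma\cap\mathrm{Lk}(v))\cup\{v\}$ and powers $\Sigma(u)$ for $u\in\mathrm{Lk}(v)$, $\Sigma(v)-1$ at $v$ (and $0$ elsewhere); in all other cases $\delta(\Sigma,v^{\pm1})=q_{\mathrm{rej}}$. Then the language accepted by $\mathcal{D}$ is exactly the set of geodesic words of $\mathrm{NGP}(\Gamma,N)$ with respect to $S$.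
   Context: A numbered graph $(\Gamma,N)$ is a finite simplicial graph $\Gamma$ with a map $N:V\Gamma\to\{2,3,\dots\}$; $\mathrm{NGP}(\Gamma,N)=\langle v\in V\Gamma\mid v^{N(v)}=1,\ uv=vu\text{ for }\{u,v\}\in E\Gamma\rangle$, with standard generating set $S=V\Gamma\cup(V\Gamma)^{ -1}$ (with $v^{ -1}=v$ when $N(v)=2$). A word over $S$ is geodesic if no shorter word over $S$ represents the same element. A clique is a vertex set spanning a complete subgraph; $\mathrm{Lk}(v)$ is the set of neighbours of $v$. A powered clique is a map $\Sigma:V\Gamma\to\mathbb{Z}$ whose support $\mathrm{supp}\,\Sigma=\{v\mid\Sigma(v)\ne0\}$ is a clique and with $0\le\Sigma(v)\le1$ if $N(v)=2$ and $-\lfloor N(v)/2\rfloor\le\Sigma(v)\le\lfloor N(v)/2\rfloor$ otherwise. The FSA accepts a word if processing it from the start state ends in an accept state. -}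

module Defs where

open import Data.Nat as ℕ using (ℕ; _/_)
open import Data.Integer as ℤ using (ℤ; +_; _≤?_; _<?_; _+_; _-_; -_)
open import Data.Fin using (Fin; _≟_)
open import Data.Bool using (Bool; true; false; not; if_then_else_; _∧_; T)
open import Data.List using (List; []; _∷_; _++_; replicate; foldl; length)
open import Data.Maybe using (Maybe; just; nothing; _>>=_; is-just)
open import Data.Product using (_×_; _,_)
open import Relation.Nullary using (does; ¬_)
open import Relation.Binary.PropositionalEquality using (_≡_)

-- A numbered graph: vertex set Fin n, adjacency E (simplicial: symmetric,
-- irreflexive; these hypotheses are imposed in the theorem), numbering N.

-- The standard generating set S.  `gen v` is v, `inv v` is v⁻¹, which is a
-- separate letter only when N v ≠ 2 (otherwise v⁻¹ = v is the letter gen v).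

data Letter {n : ℕ} (N : Fin n → ℕ) : Set where
  gen : Fin n → Letter N
  inv : (v : Fin n) → .(¬ (N v ≡ 2)) → Letter N

-- The group NGP(Γ,N) via its presentation: words over the free-group
-- alphabet (v , false) = v, (v , true) = v⁻¹, modulo the congruence
-- generated by free cancellation and the defining relators.

FLetter : ℕ → Set
FLetter n = Fin n × Bool

FWord : ℕ → Set
FWord n = List (FLetter n)

data Rel {n : ℕ} (E : Fin n → Fin n → Bool) (N : Fin n → ℕ) :
         FWord n → FWord n → Set where
  cancel : (v : Fin n) (b : Bool) → Rel E N ((v , b) ∷ (v , not b) ∷ []) []
  power  : (v : Fin n) → Rel E N (replicate (N v) (v , false)) []
  comm   : (u v : Fin n) → T (E u v) →
           Rel E N ((u , false) ∷ (v , false) ∷ []) ((v , false) ∷ (u , false) ∷ [])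

data _≈⟨_,_⟩_ {n : ℕ} : FWord n → (Fin n → Fin n → Bool) → (Fin n → ℕ) → FWord n → Set where
  ≈-refl  : ∀ {E N w} → w ≈⟨ E , N ⟩ w
  ≈-sym   : ∀ {E N w w'} → w ≈⟨ E , N ⟩ w' → w' ≈⟨ E , N ⟩ w
  ≈-trans : ∀ {E N w w' w''} → w ≈⟨ E , N ⟩ w' → w' ≈⟨ E , N ⟩ w'' → w ≈⟨ E , N ⟩ w''
  ≈-rel   : ∀ {E N l r} (a b : FWord n) → Rel E N l r →
            (a ++ l ++ b) ≈⟨ E , N ⟩ (a ++ r ++ b)

⟦_⟧ˡ : ∀ {n} {N : Fin n → ℕ} → Letter N → FLetter n
⟦ gen v ⟧ˡ   = v , false
⟦ inv v _ ⟧ˡ = v , true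

⟦_⟧ : ∀ {n} {N : Fin n → ℕ} → List (Letter N) → FWord n
⟦ [] ⟧    = []
⟦ x ∷ w ⟧ = ⟦ x ⟧ˡ ∷ ⟦ w ⟧

Geodesic : ∀ {n} (E : Fin n → Fin n → Bool) (N : Fin n → ℕ) → List (Letter N) → Set
Geodesic E N w = ∀ (w' : List (Letter N)) →
  ⟦ w' ⟧ ≈⟨ E , N ⟩ ⟦ w ⟧ → length w ℕ.≤ length w'

-- The automaton 𝒟.  A state is `just Σ` (a powered clique Σ : V → ℤ) or
-- `nothing` (the reject state q_rej).

half : ℕ → ℤ
half m = + (m / 2)

update : ∀ {n} (E : Fin n → Fin n → Bool) → (Fin n → ℤ) → Fin n → ℤ → (Fin n → ℤ)
update E Σ v new u =
  if does (u ≟ v) then new else (if E u v then Σ u else + 0)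

δ : ∀ {n} (E : Fin n → Fin n → Bool) (N : Fin n → ℕ) →
    Maybe (Fin n → ℤ) → Letter N → Maybe (Fin n → ℤ)
δ E N nothing  _ = nothing
δ E N (just Σ) (gen v) =
  if does (+ 0 ≤? Σ v) ∧ does (Σ v <? half (N v))
  then just (update E Σ v (Σ v + + 1)) else nothing
δ E N (just Σ) (inv v _) =
  if does (- half (N v) <? Σ v) ∧ does (Σ v ≤? + 0)
  then just (update E Σ v (Σ v - + 1)) else nothing

start : ∀ {n} → Maybe (Fin n → ℤ)
start = just (λ _ → + 0)

run : ∀ {n} (E : Fin n → Fin n → Bool) (N : Fin n → ℕ) → List (Letter N) → Maybe (Fin n → ℤ)
run E N w = foldl (δ E N) start w

Accepts : ∀ {n} (E : Fin n → Fin n → Bool) (N : Fin n → ℕ) → List (Letter N) → Set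
Accepts E N w = T (is-just (run E N w))

-- The group acts on configurations that give each vertex v a
-- stack of the v-syllables of a normal form, each syllable carrying its exponent modulo N v and
-- its depth, the number of later syllables on v or on vertices not adjacent to v.  The cost of a
-- configuration, the sum of min(k, N v - k) over its syllables of exponent k, is invariant under
-- the defining relations and grows by at most one per letter, so it bounds word length from
-- below.  Along an accepted word it grows by exactly one per letter: the powered clique reached
-- is the family of exponents of the syllables of depth zero, and a letter is accepted only if it
-- moves such an exponent away from 0 inside the range (-N v/2, N v/2].
--
-- If Σ(v) = ±k ≠ 0 after an accepted prefix p, the last k letters
-- of p that involve v can be commuted to the end: p = q v^{±k} with |q| + k = |p|.  A rejected
-- letter either cancels against this block, or makes it v^{±(k+1)} with k + 1 > ⌊N v/2⌋, which
-- equals the shorter v^{∓(N v-k-1)}.  Either way the word has a shorter representative.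

module Submission where

open import Defs
open import Data.Nat using (ℕ; _≤_)
open import Data.Fin using (Fin)
open import Data.Bool using (Bool; false)
open import Data.List using (List)
open import Data.Product using (_×_)
open import Relation.Binary.PropositionalEquality using (_≡_)

open import Algebra.Bundles using (AbelianGroup)
open import Data.Bool using (true; not; if_then_else_; T)
open import Data.Empty using (⊥-elim)
open import Data.Fin as F using ()
import Data.Fin.Properties as FP
open import Data.Integer as ℤ using (ℤ; +_; -[1+_])
import Data.Integer.Properties as ℤP
open import Data.List using ([]; _∷_; _++_; replicate; map; foldl; length)
import Data.List.Properties as LP
open import Data.Maybe using (just; nothing; is-just)
open import Data.Maybe.Properties using (just-injective)
open import Data.Nat as ℕ using (zero; suc; _∸_; _⊓_; z≤n; s≤s; _<_)
import Data.Nat.DivMod as DM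
import Data.Nat.Properties as ℕP
open import Data.Product using (_,_; proj₁; proj₂; map₂; ∃)
open import Data.Sum using (_⊎_; inj₁; inj₂)
open import Data.Unit using (⊤; tt)
open import Data.Vec.Functional using (removeAt)
open import Function using (_∘_)
open import Relation.Binary.Bundles using (Setoid)
open import Relation.Binary.PropositionalEquality
import Relation.Binary.Reasoning.Setoid
open import Relation.Nullary using (¬_; Dec; does; yes; no)
open import Relation.Nullary.Decidable using (dec-true; dec-false)

open import Algebra.Properties.Group (AbelianGroup.group ℤP.+-0-abelianGroup) using (∙-cancelʳ)
open import Algebra.Properties.CommutativeSemigroup ℤP.+-commutativeSemigroup using (xy∙z≈xz∙y)
open import Algebra.Properties.CommutativeSemigroup ℕP.+-commutativeSemigroup using (xy∙z≈zy∙x)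
open import Algebra.Properties.CommutativeMonoid.Sum ℕP.+-0-commutativeMonoid
  using (sum; sum-remove; sum-cong-≗; sum-replicate-zero)

m∸n≤1+m∸[1+n] : ∀ m n → m ∸ n ≤ suc (m ∸ suc n)
m∸n≤1+m∸[1+n] zero    zero    = z≤n
m∸n≤1+m∸[1+n] zero    (suc n) = z≤n
m∸n≤1+m∸[1+n] (suc m) zero    = ℕP.≤-refl
m∸n≤1+m∸[1+n] (suc m) (suc n) = m∸n≤1+m∸[1+n] m n

replicate-+ : ∀ {A : Set} m n (x : A) → replicate (m ℕ.+ n) x ≡ replicate m x ++ replicate n x
replicate-+ zero    n x = refl
replicate-+ (suc m) n x = cong (x ∷_) (replicate-+ m n x)

replicate-snoc : ∀ {A : Set} k (x : A) → replicate (suc k) x ≡ replicate k x ++ x ∷ []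
replicate-snoc k x = trans (cong (λ m → replicate m x) (ℕP.+-comm 1 k)) (replicate-+ k 1 x)

m/2*2≡m/2+m/2 : ∀ m → m ℕ./ 2 ℕ.* 2 ≡ m ℕ./ 2 ℕ.+ m ℕ./ 2
m/2*2≡m/2+m/2 m = trans (ℕP.*-comm (m ℕ./ 2) 2) (cong (m ℕ./ 2 ℕ.+_) (ℕP.+-identityʳ (m ℕ./ 2)))

j≤m/2⇒j+j≤m : ∀ m {j} → j ≤ m ℕ./ 2 → j ℕ.+ j ≤ m
j≤m/2⇒j+j≤m m {j} le = begin
  j ℕ.+ j                 ≤⟨ ℕP.+-mono-≤ le le ⟩
  m ℕ./ 2 ℕ.+ m ℕ./ 2     ≡⟨ m/2*2≡m/2+m/2 m ⟨
  m ℕ./ 2 ℕ.* 2           ≤⟨ DM.m/n*n≤m m 2 ⟩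
  m                       ∎
  where open ℕP.≤-Reasoning

m≤1+m/2+m/2 : ∀ m → m ≤ suc (m ℕ./ 2 ℕ.+ m ℕ./ 2)
m≤1+m/2+m/2 m = begin
  m                            ≡⟨ DM.m≡m%n+[m/n]*n m 2 ⟩
  m ℕ.% 2 ℕ.+ m ℕ./ 2 ℕ.* 2    ≤⟨ ℕP.+-mono-≤ (ℕ.s≤s⁻¹ (DM.m%n<n m 2)) (ℕP.≤-reflexive (m/2*2≡m/2+m/2 m)) ⟩
  suc (m ℕ./ 2 ℕ.+ m ℕ./ 2)    ∎
  where open ℕP.≤-Reasoning

i≤j⇒i+i≤j+j : ∀ {i j} → i ≤ j → i ℕ.+ i ≤ j ℕ.+ j
i≤j⇒i+i≤j+j i≤j = ℕP.+-mono-≤ i≤j i≤j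

j+j≤m⇒j<m : ∀ {j m} → 1 ≤ j → j ℕ.+ j ≤ m → j < m
j+j≤m⇒j<m {j} 1≤j le = ℕP.<-≤-trans (ℕP.m<m+n j 1≤j) le

-h<0⇒1≤h : ∀ {h} → ℤ.- (+ h) ℤ.< + 0 → 1 ≤ h
-h<0⇒1≤h {suc h} _ = s≤s z≤n
-h<0⇒1≤h {zero} (ℤ.+<+ ())

-h<-[1+m]⇒2+m≤h : ∀ {h m} → ℤ.- (+ h) ℤ.< -[1+ m ] → suc (suc m) ≤ h
-h<-[1+m]⇒2+m≤h {suc h} (ℤ.-<- lt) = s≤s lt

⟦⟧-++ : ∀ {n} {N : Fin n → ℕ} (a b : List (Letter N)) → ⟦ a ++ b ⟧ ≡ ⟦ a ⟧ ++ ⟦ b ⟧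
⟦⟧-++ []      b = refl
⟦⟧-++ (x ∷ a) b = cong (⟦ x ⟧ˡ ∷_) (⟦⟧-++ a b)

⟦⟧-replicate : ∀ {n} {N : Fin n → ℕ} k (ℓ : Letter N) → ⟦ replicate k ℓ ⟧ ≡ replicate k ⟦ ℓ ⟧ˡ
⟦⟧-replicate zero    ℓ = refl
⟦⟧-replicate (suc k) ℓ = cong (⟦ ℓ ⟧ˡ ∷_) (⟦⟧-replicate k ℓ)

length-⟦⟧ : ∀ {n} {N : Fin n → ℕ} (w : List (Letter N)) → length ⟦ w ⟧ ≡ length w
length-⟦⟧ []      = refl
length-⟦⟧ (_ ∷ w) = cong suc (length-⟦⟧ w)

-- A syllable is (exponent in [1, N v), depth); a stack lists the v-syllables latest first, and a
-- syllable of depth 0 can be moved to the end of the word.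
Syllable : Set
Syllable = ℕ × ℤ

Stack : Set
Stack = List Syllable

raise : ℤ → Stack → Stack
raise d = map (map₂ (ℤ._+ d))

raise-raise : ∀ d e l → raise d (raise e l) ≡ raise (e ℤ.+ d) l
raise-raise d e []            = refl
raise-raise d e ((k , c) ∷ l) = cong₂ _∷_ (cong (k ,_) (ℤP.+-assoc c e d)) (raise-raise d e l)

raise-identity : ∀ l → raise (+ 0) l ≡ l
raise-identity []            = refl
raise-identity ((k , c) ∷ l) = cong₂ _∷_ (cong (k ,_) (ℤP.+-identityʳ c)) (raise-identity l)

raise-inverse : ∀ d e l → e ℤ.+ d ≡ + 0 → raise d (raise e l) ≡ l
raise-inverse d e l e+d≡0 =
  trans (raise-raise d e l) (trans (cong (λ z → raise z l) e+d≡0) (raise-identity l))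

raise-comm : ∀ d e l → raise d (raise e l) ≡ raise e (raise d l)
raise-comm d e l =
  trans (raise-raise d e l) (trans (cong (λ z → raise z l) (ℤP.+-comm e d)) (sym (raise-raise e d l)))

turn : ℕ → Bool → ℕ → ℕ
turn M false k = if does (suc k ℕ.≟ M) then 0 else suc k
turn M true  k = ℕ.pred k

unit : ℕ → Bool → ℕ
unit M false = 1
unit M true  = M ∸ 1

turn-up : ∀ {M k} → suc k ≢ M → turn M false k ≡ suc k
turn-up {M} {k} ne rewrite dec-false (suc k ℕ.≟ M) ne = refl

turn-top : ∀ {M k} → suc k ≡ M → turn M false k ≡ 0
turn-top {M} {k} eq rewrite dec-true (suc k ℕ.≟ M) eq = refl

turn-forward : ∀ M k → (suc k ≡ M × turn M false k ≡ 0) ⊎ (suc k ≢ M × turn M false k ≡ suc k)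
turn-forward M k with suc k ℕ.≟ M
... | yes eq = inj₁ (eq , turn-top eq)
... | no ne  = inj₂ (ne , turn-up ne)

turn-bounded : ∀ {M} b {k k′} → k < M → turn M b k ≡ suc k′ → suc k′ < M
turn-bounded {M} false {k} lt eq with turn-forward M k
... | inj₁ (_ , t≡0)  = ⊥-elim (ℕP.0≢1+n (trans (sym t≡0) eq))
... | inj₂ (ne , t≡) = subst (_< M) (trans (sym t≡) eq) (ℕP.≤∧≢⇒< lt ne)
turn-bounded true {suc k} lt refl = ℕP.<-trans (ℕP.n<1+n k) lt

turn-unit : ∀ {M} b → 2 ≤ M → turn M (not b) (unit M b) ≡ 0
turn-unit false _               = refl
turn-unit {suc M} true (s≤s _) = turn-top refl

turn≡0 : ∀ {M} b {k} → 1 ≤ k → turn M b k ≡ 0 → k ≡ unit M (not b)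
turn≡0 {M} false {k} _ eq with turn-forward M k
... | inj₁ (refl , _) = refl
... | inj₂ (_ , t≡)   = ⊥-elim (ℕP.1+n≢0 (trans (sym t≡) eq))
turn≡0 true {suc zero} _ _ = refl

turn-turn : ∀ {M} b {k k′} → k < M → turn M b k ≡ suc k′ → turn M (not b) (suc k′) ≡ k
turn-turn {M} false {k} _ eq with turn-forward M k
... | inj₁ (_ , t≡0) = ⊥-elim (ℕP.0≢1+n (trans (sym t≡0) eq))
... | inj₂ (_ , t≡)  = cong ℕ.pred (sym (trans (sym t≡) eq))
turn-turn true {suc (suc k′)} lt refl = turn-up (ℕP.<⇒≢ lt)

unit-bounded : ∀ {M} b → 2 ≤ M → 1 ≤ unit M b × unit M b < M
unit-bounded false                 le = s≤s z≤n , le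
unit-bounded {suc (suc M)} true _ = s≤s z≤n , ℕP.≤-refl
unit-bounded {suc zero} true (s≤s ())

weight : ℕ → ℕ → ℕ
weight M k = k ⊓ (M ∸ k)

weight-turn : ∀ M b k → weight M (turn M b k) ≤ suc (weight M k)
weight-turn M false k with turn-forward M k
... | inj₁ (_ , t≡0) rewrite t≡0 = z≤n
... | inj₂ (_ , t≡)  rewrite t≡  =
  ℕP.⊓-mono-≤ (ℕP.≤-refl {suc k}) (ℕP.≤-trans (ℕP.∸-monoʳ-≤ M (ℕP.n≤1+n k)) (ℕP.n≤1+n (M ∸ k)))
weight-turn M true zero    = z≤n
weight-turn M true (suc k) = ℕP.⊓-mono-≤ (ℕP.m≤n+m k 2) (m∸n≤1+m∸[1+n] M k)

weight-unit : ∀ M b → weight M (unit M b) ≤ 1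
weight-unit M       false = ℕP.m⊓n≤m 1 (M ∸ 1)
weight-unit zero    true  = z≤n
weight-unit (suc M) true  = ℕP.≤-trans (ℕP.m⊓n≤n M (suc M ∸ M)) (ℕP.≤-reflexive (ℕP.m+n∸n≡m 1 M))

weight-small : ∀ {M j} → j ℕ.+ j ≤ M → weight M j ≡ j
weight-small {M} {j} le = ℕP.m≤n⇒m⊓n≡m (ℕP.m+n≤o⇒m≤o∸n j le)

weight-large : ∀ {M j} → j ℕ.+ j ≤ M → weight M (M ∸ j) ≡ j
weight-large {M} {j} le rewrite ℕP.m∸[m∸n]≡n (ℕP.m+n≤o⇒n≤o j le) =
  ℕP.m≥n⇒m⊓n≡n (ℕP.m+n≤o⇒m≤o∸n j le)

weight-small-suc : ∀ {M j} → suc j ℕ.+ suc j ≤ M → weight M (suc j) ≡ suc (weight M j)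
weight-small-suc {j = j} le =
  trans (weight-small le) (cong suc (sym (weight-small (ℕP.≤-trans (i≤j⇒i+i≤j+j (ℕP.n≤1+n j)) le))))

weight-large-suc : ∀ {M j} → suc j ℕ.+ suc j ≤ M → weight M (M ∸ suc j) ≡ suc (weight M (M ∸ j))
weight-large-suc {j = j} le =
  trans (weight-large le) (cong suc (sym (weight-large (ℕP.≤-trans (i≤j⇒i+i≤j+j (ℕP.n≤1+n j)) le))))

cost : ℕ → Stack → ℕ
cost M []            = 0
cost M ((k , _) ∷ l) = weight M k ℕ.+ cost M l

cost-raise : ∀ M d l → cost M (raise d l) ≡ cost M l
cost-raise M d []            = refl
cost-raise M d ((k , _) ∷ l) = cong (weight M k ℕ.+_) (cost-raise M d l)

Covered : Stack → Set
Covered []            = ⊤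
Covered ((_ , c) ∷ _) = c ≢ + 0

Separated : ℤ → Stack → Set
Separated c []             = ⊤
Separated c ((_ , c′) ∷ _) = c′ ≢ c ℤ.+ + 1

-- Consecutive v-syllables whose depths differ by exactly one have nothing between them that keeps
-- them from merging.
Reduced : ℕ → Stack → Set
Reduced M []            = ⊤
Reduced M ((k , c) ∷ l) = 1 ≤ k × k < M × Separated c l × Reduced M l

Separated-raise : ∀ d c l → Separated c l → Separated (c ℤ.+ d) (raise d l)
Separated-raise d c []             _       = tt
Separated-raise d c ((_ , c′) ∷ l) sep eq = sep (∙-cancelʳ d c′ (c ℤ.+ + 1) (trans eq (xy∙z≈xz∙y c d (+ 1))))

Reduced-raise : ∀ M d l → Reduced M l → Reduced M (raise d l)
Reduced-raise M d []            _                      = tt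
Reduced-raise M d ((k , c) ∷ l) (1≤k , k<M , sep , red) =
  1≤k , k<M , Separated-raise d c l sep , Reduced-raise M d l red

Covered⇒Separated : ∀ l → Covered l → Separated (+ 0) (raise (+ 1) l)
Covered⇒Separated []            _   = tt
Covered⇒Separated ((_ , c) ∷ _) c≢0 eq = c≢0 (∙-cancelʳ (+ 1) c (+ 0) eq)

Separated⇒Covered : ∀ l → Separated (+ 0) l → Covered (raise -[1+ 0 ] l)
Separated⇒Covered []             _   = tt
Separated⇒Covered ((_ , c) ∷ _) sep eq = sep (∙-cancelʳ -[1+ 0 ] c (+ 1) eq)

push : ℕ → Bool → Stack → Stack × ℤ
push M b l = (unit M b , + 0) ∷ raise (+ 1) l , + 1

settle : ℕ → Stack → Stack × ℤ
settle zero    l = raise -[1+ 0 ] l , -[1+ 0 ]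
settle (suc k) l = (suc k , + 0) ∷ l , + 0

-- Multiplication by v (b = false) or v⁻¹ (b = true): an exposed top syllable absorbs the letter and
-- vanishes when its exponent reaches 0, otherwise a new syllable is pushed.  The second component is
-- the change in the number of v-syllables, by which the stacks of vertices not adjacent to v are raised.
mulStack : ℕ → Bool → Stack → Stack × ℤ
mulStack M b ((k , + zero) ∷ l) = settle (turn M b k) l
mulStack M b l                  = push M b l

mulStack-covered : ∀ M b l → Covered l → mulStack M b l ≡ push M b l
mulStack-covered M b []                      _   = refl
mulStack-covered M b ((k , + zero) ∷ l)     c≢0 = ⊥-elim (c≢0 refl)
mulStack-covered M b ((k , + suc _) ∷ l)    _   = refl
mulStack-covered M b ((k , -[1+ _ ]) ∷ l)   _   = refl

Reduced-push : ∀ {M} b l → 2 ≤ M → Covered l → Reduced M l → Reduced M (proj₁ (push M b l))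
Reduced-push b l 2≤M cov red =
  proj₁ (unit-bounded b 2≤M) , proj₂ (unit-bounded b 2≤M) , Covered⇒Separated l cov , Reduced-raise _ (+ 1) l red

Reduced-settle : ∀ {M} b k l → k < M → Separated (+ 0) l → Reduced M l →
                 Reduced M (proj₁ (settle (turn M b k) l))
Reduced-settle {M} b k l k<M sep red with turn M b k in eq
... | zero   = Reduced-raise M _ l red
... | suc k′ = s≤s z≤n , turn-bounded b k<M eq , sep , red

Reduced-mulStack : ∀ {M} b l → 2 ≤ M → Reduced M l → Reduced M (proj₁ (mulStack M b l))
Reduced-mulStack b []                    2≤M red = Reduced-push b [] 2≤M tt red
Reduced-mulStack b ((k , + zero) ∷ l)   2≤M (_ , k<M , sep , red) = Reduced-settle b k l k<M sep red
Reduced-mulStack b l@((k , + suc _) ∷ _) 2≤M red = Reduced-push b l 2≤M (λ ()) red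
Reduced-mulStack b l@((k , -[1+ _ ]) ∷ _) 2≤M red = Reduced-push b l 2≤M (λ ()) red

cost-settle : ∀ M t l → cost M (proj₁ (settle t l)) ≤ weight M t ℕ.+ cost M l
cost-settle M zero    l = ℕP.≤-reflexive (cost-raise M _ l)
cost-settle M (suc t) l = ℕP.≤-refl

cost-push : ∀ M b l → cost M (proj₁ (push M b l)) ≤ suc (cost M l)
cost-push M b l rewrite cost-raise M (+ 1) l = ℕP.+-monoˡ-≤ (cost M l) (weight-unit M b)

cost-mulStack : ∀ M b l → cost M (proj₁ (mulStack M b l)) ≤ suc (cost M l)
cost-mulStack M b []                       = cost-push M b []
cost-mulStack M b ((k , + zero) ∷ l)      =
  ℕP.≤-trans (cost-settle M (turn M b k) l) (ℕP.+-monoˡ-≤ (cost M l) (weight-turn M b k))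
cost-mulStack M b l@((_ , + suc _) ∷ _)   = cost-push M b l
cost-mulStack M b l@((_ , -[1+ _ ]) ∷ _)  = cost-push M b l

runStack : ℕ → List Bool → Stack → Stack × ℤ
runStack M []       l = l , + 0
runStack M (b ∷ bs) l = let (l₁ , d₁) = mulStack M b l in map₂ (λ e → d₁ ℤ.+ e) (runStack M bs l₁)

-- A record rather than the bare equation, so that its indices guide unification in chains of _▷_.
record Runs (M : ℕ) (bs : List Bool) (l l′ : Stack) (d : ℤ) : Set where
  constructor runs
  field ran : runStack M bs l ≡ (l′ , d)
open Runs

runStack-++ : ∀ M bs cs l →
  runStack M (bs ++ cs) l ≡ (let (l₁ , d₁) = runStack M bs l in map₂ (λ e → d₁ ℤ.+ e) (runStack M cs l₁))
runStack-++ M []       cs l = cong (proj₁ (runStack M cs l) ,_) (sym (ℤP.+-identityˡ _))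
runStack-++ M (b ∷ bs) cs l =
  trans (cong (map₂ (λ e → d ℤ.+ e)) (runStack-++ M bs cs l′))
        (cong (proj₁ (runStack M cs l₁) ,_) (sym (ℤP.+-assoc d (proj₂ (runStack M bs l′)) _)))
  where
  l′ = proj₁ (mulStack M b l)
  l₁ = proj₁ (runStack M bs l′)
  d  = proj₂ (mulStack M b l)

infixr 5 _▷_
_▷_ : ∀ {M bs cs l l₁ l₂ d₁ d₂} → Runs M bs l l₁ d₁ → Runs M cs l₁ l₂ d₂ →
      Runs M (bs ++ cs) l l₂ (d₁ ℤ.+ d₂)
_▷_ {M} {bs} {cs} {l} {d₁ = d₁} (runs r₁) (runs r₂) =
  runs (trans (runStack-++ M bs cs l)
              (trans (cong (λ p → map₂ (λ e → proj₂ p ℤ.+ e) (runStack M cs (proj₁ p))) r₁)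
                     (cong (map₂ (λ e → d₁ ℤ.+ e)) r₂)))

runs-≡ : ∀ {M bs l l′ l″ d} → l′ ≡ l″ → Runs M bs l l′ d → Runs M bs l l″ d
runs-≡ refl r = r

runs-push : ∀ {M} b l → Covered l → Runs M (b ∷ []) l ((unit M b , + 0) ∷ raise (+ 1) l) (+ 1)
runs-push {M} b l cov = runs (cong (λ p → proj₁ p , proj₂ p ℤ.+ + 0) (mulStack-covered M b l cov))

runs-settle : ∀ {M} b {k t} l → turn M b k ≡ t →
              Runs M (b ∷ []) ((k , + 0) ∷ l) (proj₁ (settle t l)) (proj₂ (settle t l))
runs-settle b {t = t} l refl = runs (cong (proj₁ (settle t l) ,_) (ℤP.+-identityʳ _))

runs-up : ∀ {M} m {j} l → suc j ℕ.+ m < M →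
          Runs M (replicate m false) ((suc j , + 0) ∷ l) ((suc j ℕ.+ m , + 0) ∷ l) (+ 0)
runs-up zero    {j} l _  rewrite ℕP.+-identityʳ j = runs refl
runs-up (suc m) {j} l lt rewrite ℕP.+-suc j m =
  runs-settle false l (turn-up (ℕP.<⇒≢ (ℕP.≤-<-trans (s≤s (s≤s (ℕP.m≤m+n j m))) lt))) ▷
  runs-up m {suc j} l lt

runs-wrap : ∀ {M k} l → suc k ≡ M → Runs M (false ∷ []) ((k , + 0) ∷ l) (raise -[1+ 0 ] l) -[1+ 0 ]
runs-wrap l eq = runs-settle false l (turn-top eq)

runStack-cancel-covered : ∀ {M} b l → 2 ≤ M → Covered l → Runs M (b ∷ not b ∷ []) l l (+ 0)
runStack-cancel-covered b l 2≤M cov =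
  runs-push b l cov ▷ runs-≡ (raise-inverse _ _ l refl) (runs-settle (not b) (raise (+ 1) l) (turn-unit b 2≤M))

runStack-cancel : ∀ {M} b l → 2 ≤ M → Reduced M l → Runs M (b ∷ not b ∷ []) l l (+ 0)
runStack-cancel b []                      2≤M _ = runStack-cancel-covered b [] 2≤M tt
runStack-cancel b l@((_ , + suc _) ∷ _)  2≤M _ = runStack-cancel-covered b l 2≤M (λ ())
runStack-cancel b l@((_ , -[1+ _ ]) ∷ _) 2≤M _ = runStack-cancel-covered b l 2≤M (λ ())
runStack-cancel {M} b ((k , + zero) ∷ l) 2≤M (1≤k@(s≤s z≤n) , k<M , sep , _) with turn M b k in eq
... | zero   = runs-settle b l eq ▷
               runs-≡ (cong₂ _∷_ (cong (_, + 0) (sym (turn≡0 b 1≤k eq))) (raise-inverse _ _ l refl))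
                      (runs-push (not b) (raise -[1+ 0 ] l) (Separated⇒Covered l sep))
... | suc _  = runs-settle b l eq ▷ runs-settle (not b) l (turn-turn b k<M eq)

runStack-power-covered : ∀ {M} l → 2 ≤ M → Covered l → Runs M (replicate M false) l l (+ 0)
runStack-power-covered {suc (suc m)} l _ cov =
  subst (λ w → Runs (suc (suc m)) w l l (+ 0)) (cong (false ∷_) (sym (replicate-snoc m false)))
    (runs-push false l cov ▷ runs-up m (raise (+ 1) l) ℕP.≤-refl ▷
     runs-≡ (raise-inverse _ _ l refl) (runs-wrap (raise (+ 1) l) refl))
runStack-power-covered {suc zero} l (s≤s ()) _

runStack-power-exposed : ∀ {M k} l → suc k < M → Separated (+ 0) l →
                         Runs M (replicate M false) ((suc k , + 0) ∷ l) ((suc k , + 0) ∷ l) (+ 0)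
runStack-power-exposed {M} {k} l k<M sep =
  subst (λ w → Runs M w _ _ (+ 0)) word≡
    (runs-up a l (ℕP.≤-reflexive (ℕP.m+[n∸m]≡n k<M)) ▷
     runs-wrap l (ℕP.m+[n∸m]≡n k<M) ▷
     runs-≡ (cong (_ ∷_) (raise-inverse _ _ l refl))
            (runs-push false (raise -[1+ 0 ] l) (Separated⇒Covered l sep)) ▷
     runs-up k {0} l k<M)
  where
  a : ℕ
  a = M ∸ suc (suc k)
  word≡ : replicate a false ++ false ∷ false ∷ replicate k false ≡ replicate M false
  word≡ = trans (sym (replicate-+ a (2 ℕ.+ k) false)) (cong (λ m → replicate m false) (ℕP.m∸n+n≡m k<M))

runStack-power : ∀ {M} l → 2 ≤ M → Reduced M l → Runs M (replicate M false) l l (+ 0)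
runStack-power []                       2≤M _ = runStack-power-covered [] 2≤M tt
runStack-power l@((_ , + suc _) ∷ _)   2≤M _ = runStack-power-covered l 2≤M (λ ())
runStack-power l@((_ , -[1+ _ ]) ∷ _)  2≤M _ = runStack-power-covered l 2≤M (λ ())
runStack-power ((suc k , + zero) ∷ l) 2≤M (_ , k<M , sep , _) = runStack-power-exposed l k<M sep

-- Covered, in a form that survives raising by a non-negative amount.
Buried : Stack → Set
Buried []            = ⊤
Buried ((_ , c) ∷ _) = + 1 ℤ.≤ c

Buried⇒Covered : ∀ l → Buried l → Covered l
Buried⇒Covered []            _   = tt
Buried⇒Covered ((_ , _) ∷ _) (ℤ.+≤+ ()) refl

Buried-raise : ∀ {d} l → + 0 ℤ.≤ d → Buried l → Buried (raise d l)
Buried-raise []            _   _   = tt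
Buried-raise ((_ , c) ∷ _) 0≤d 1≤c = ℤP.+-mono-≤ 1≤c 0≤d

-- The automaton's power Σ(v) is the exponent of the exposed top v-syllable, read in (-N v/2, N v/2];
-- Σ(v) = 0 when no v-syllable is exposed.
Tracks : ℕ → ℤ → Stack → Set
Tracks M (+ zero)   l = Buried l
Tracks M (+ suc k)  l = ∃ λ rest → l ≡ (suc k , + 0) ∷ rest
Tracks M -[1+ m ]   l = ∃ λ rest → l ≡ (M ∸ suc m , + 0) ∷ rest

Tracks-nonzero⇒Buried-raise : ∀ {M z} l → z ≢ + 0 → Tracks M z l → Buried (raise (+ 1) l)
Tracks-nonzero⇒Buried-raise {z = + zero}   _ z≢0 _           = ⊥-elim (z≢0 refl)
Tracks-nonzero⇒Buried-raise {z = + suc _}  _ _   (_ , refl) = ℤP.≤-refl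
Tracks-nonzero⇒Buried-raise {z = -[1+ _ ]} _ _   (_ , refl) = ℤP.≤-refl

record Advance (M : ℕ) (z z′ : ℤ) (l : Stack) (r : Stack × ℤ) : Set where
  field
    tracks-next : Tracks M z′ (proj₁ r)
    growth≥0    : + 0 ℤ.≤ proj₂ r
    growth-new  : z ≡ + 0 → proj₂ r ≡ + 1
    cost-suc    : cost M (proj₁ r) ≡ suc (cost M l)

settle-nonzero : ∀ {t} l → t ≢ 0 → settle t l ≡ ((t , + 0) ∷ l , + 0)
settle-nonzero {zero}  l t≢0 = ⊥-elim (t≢0 refl)
settle-nonzero {suc t} l _   = refl

mulStack-up : ∀ {M k} l → suc (suc k) < M → mulStack M false ((suc k , + 0) ∷ l) ≡ ((suc (suc k) , + 0) ∷ l , + 0)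
mulStack-up l lt = cong (λ t → settle t l) (turn-up (ℕP.<⇒≢ lt))

mulStack-down : ∀ {M m} l → suc (suc m) < M →
                mulStack M true ((M ∸ suc m , + 0) ∷ l) ≡ ((M ∸ suc (suc m) , + 0) ∷ l , + 0)
mulStack-down {M} {m} l lt =
  trans (cong (λ t → settle t l) (ℕP.pred[m∸n]≡m∸[1+n] M (suc m))) (settle-nonzero l (ℕP.m>n⇒m∸n≢0 lt))

advance-push : ∀ {M} b {z z′} l → 2 ≤ M → Buried l → z ≡ + 0 →
               Tracks M z′ ((unit M b , + 0) ∷ raise (+ 1) l) → weight M (unit M b) ≡ 1 →
               Advance M z z′ l (mulStack M b l)
advance-push {M} b l 2≤M bur refl tr w≡1 rewrite mulStack-covered M b l (Buried⇒Covered l bur) = record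
  { tracks-next = tr
  ; growth≥0    = ℤ.+≤+ z≤n
  ; growth-new  = λ _ → refl
  ; cost-suc    = cong₂ ℕ._+_ w≡1 (cost-raise M (+ 1) l)
  }

advance-up : ∀ {M k} rest → suc (suc k) ℕ.+ suc (suc k) ≤ M →
             Advance M (+ suc k) (+ suc k ℤ.+ + 1) ((suc k , + 0) ∷ rest) (mulStack M false ((suc k , + 0) ∷ rest))
advance-up {M} {k} rest le rewrite mulStack-up rest (j+j≤m⇒j<m (s≤s z≤n) le) = record
  { tracks-next = rest , cong (λ j → (suc j , + 0) ∷ rest) (ℕP.+-comm 1 k)
  ; growth≥0    = ℤ.+≤+ z≤n
  ; growth-new  = λ ()
  ; cost-suc    = cong (ℕ._+ cost M rest) (weight-small-suc le)
  }

advance-down : ∀ {M m} rest → suc (suc m) ℕ.+ suc (suc m) ≤ M →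
               Advance M -[1+ m ] (-[1+ m ] ℤ.- + 1) ((M ∸ suc m , + 0) ∷ rest) (mulStack M true ((M ∸ suc m , + 0) ∷ rest))
advance-down {M} {m} rest le rewrite mulStack-down rest (j+j≤m⇒j<m (s≤s z≤n) le) = record
  { tracks-next = rest , cong (λ j → (M ∸ suc (suc j) , + 0) ∷ rest) (sym (ℕP.+-identityʳ m))
  ; growth≥0    = ℤ.+≤+ z≤n
  ; growth-new  = λ ()
  ; cost-suc    = cong (ℕ._+ cost M rest) (weight-large-suc le)
  }

advance-gen : ∀ {M z} l → 2 ≤ M → Tracks M z l → + 0 ℤ.≤ z → z ℤ.< half M →
              Advance M z (z ℤ.+ + 1) l (mulStack M false l)
advance-gen {M} {+ zero}  l 2≤M bur           _ _          =
  advance-push false l 2≤M bur refl (raise (+ 1) l , refl) (weight-small 2≤M)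
advance-gen {M} {+ suc k} _ _   (rest , refl) _ (ℤ.+<+ lt) = advance-up rest (j≤m/2⇒j+j≤m M lt)
advance-gen {z = -[1+ _ ]} _ _ _ () _

advance-inv : ∀ {M z} l → 2 ≤ M → Tracks M z l → ℤ.- half M ℤ.< z → z ℤ.≤ + 0 →
              Advance M z (z ℤ.- + 1) l (mulStack M true l)
advance-inv {M} {+ zero}  l 2≤M bur           _ _ =
  advance-push true l 2≤M bur refl (raise (+ 1) l , refl) (weight-large 2≤M)
advance-inv {z = + suc _} _ _ _ _ (ℤ.+≤+ ())
advance-inv {M} { -[1+ m ]} _ _ (rest , refl) bnd _ = advance-down rest (j≤m/2⇒j+j≤m M (-h<-[1+m]⇒2+m≤h bnd))

module Words {n : ℕ} (E : Fin n → Fin n → Bool) (N : Fin n → ℕ) where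

  infix 4 _~_
  _~_ : FWord n → FWord n → Set
  a ~ b = a ≈⟨ E , N ⟩ b

  ~-setoid : Setoid _ _
  ~-setoid = record
    { Carrier = FWord n ; _≈_ = _~_
    ; isEquivalence = record { refl = ≈-refl ; sym = ≈-sym ; trans = ≈-trans } }

  module ~-Reasoning = Relation.Binary.Reasoning.Setoid ~-setoid
  open ~-Reasoning

  ~-reflexive : ∀ {a b} → a ≡ b → a ~ b
  ~-reflexive refl = ≈-refl

  ~-++ʳ : ∀ {a b} c → a ~ b → a ++ c ~ b ++ c
  ~-++ʳ c ≈-refl        = ≈-refl
  ~-++ʳ c (≈-sym p)     = ≈-sym (~-++ʳ c p)
  ~-++ʳ c (≈-trans p q) = ≈-trans (~-++ʳ c p) (~-++ʳ c q)
  ~-++ʳ c (≈-rel {l = l} {r = r} a b rl) =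
    subst₂ _~_ (sym (trans (LP.++-assoc a (l ++ b) c) (cong (a ++_) (LP.++-assoc l b c))))
               (sym (trans (LP.++-assoc a (r ++ b) c) (cong (a ++_) (LP.++-assoc r b c))))
               (≈-rel a (b ++ c) rl)

  ~-++ˡ : ∀ c {a b} → a ~ b → c ++ a ~ c ++ b
  ~-++ˡ c ≈-refl        = ≈-refl
  ~-++ˡ c (≈-sym p)     = ≈-sym (~-++ˡ c p)
  ~-++ˡ c (≈-trans p q) = ≈-trans (~-++ˡ c p) (~-++ˡ c q)
  ~-++ˡ c (≈-rel {l = l} {r = r} a b rl) =
    subst₂ _~_ (LP.++-assoc c a (l ++ b)) (LP.++-assoc c a (r ++ b)) (≈-rel (c ++ a) b rl)

  rel⇒~ : ∀ {l r} → Rel E N l r → l ~ r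
  rel⇒~ {l} {r} rl = subst₂ _~_ (LP.++-identityʳ l) (LP.++-identityʳ r) (≈-rel [] [] rl)

  cancel′ : ∀ v s → (v , not s) ∷ (v , s) ∷ [] ~ []
  cancel′ v false = rel⇒~ (cancel v true)
  cancel′ v true  = rel⇒~ (cancel v false)

  Commute : FLetter n → FLetter n → Set
  Commute x y = x ∷ y ∷ [] ~ y ∷ x ∷ []

  Commute-sym : ∀ {x y} → Commute x y → Commute y x
  Commute-sym = ≈-sym

  Commute-flipˡ : ∀ {u s y} → Commute (u , s) y → Commute (u , not s) y
  Commute-flipˡ {u} {s} {y} xy≈yx = begin
    (u , not s) ∷ y ∷ []
      ≈⟨ ~-++ˡ ((u , not s) ∷ y ∷ []) (rel⇒~ (cancel u s)) ⟨
    (u , not s) ∷ y ∷ (u , s) ∷ (u , not s) ∷ []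
      ≈⟨ ~-++ˡ ((u , not s) ∷ []) (~-++ʳ ((u , not s) ∷ []) xy≈yx) ⟨
    (u , not s) ∷ (u , s) ∷ y ∷ (u , not s) ∷ []
      ≈⟨ ~-++ʳ (y ∷ (u , not s) ∷ []) (cancel′ u s) ⟩
    y ∷ (u , not s) ∷ []
      ∎

  commute : ∀ {u v} → T (E u v) → ∀ s s′ → Commute (u , s) (v , s′)
  commute {u} {v} Euv s s′ = flipʳ s′ (flipˡ s (rel⇒~ (comm u v Euv)))
    where
    flipˡ : ∀ {y} s → Commute (u , false) y → Commute (u , s) y
    flipˡ false c = c
    flipˡ true  c = Commute-flipˡ c
    flipʳ : ∀ {x} s′ → Commute x (v , false) → Commute x (v , s′)
    flipʳ false c = c
    flipʳ true  c = Commute-sym (Commute-flipˡ (Commute-sym c))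

  replicate-commute : ∀ {x y} k → Commute x y → replicate k x ++ y ∷ [] ~ y ∷ replicate k x
  replicate-commute         zero    _ = ≈-refl
  replicate-commute {x} {y} (suc k) c = begin
    x ∷ replicate k x ++ y ∷ []    ≈⟨ ~-++ˡ (x ∷ []) (replicate-commute k c) ⟩
    x ∷ y ∷ replicate k x          ≈⟨ ~-++ʳ (replicate k x) c ⟩
    y ∷ x ∷ replicate k x          ∎

  replicate-cancel : ∀ v a → replicate a (v , false) ++ replicate a (v , true) ~ []
  replicate-cancel v zero    = ≈-refl
  replicate-cancel v (suc a) = begin
    replicate (suc a) (v , false) ++ replicate (suc a) (v , true)
      ≡⟨ cong (_++ replicate (suc a) (v , true)) (replicate-snoc a (v , false)) ⟩
    (replicate a (v , false) ++ (v , false) ∷ []) ++ replicate (suc a) (v , true)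
      ≡⟨ LP.++-assoc (replicate a (v , false)) _ _ ⟩
    replicate a (v , false) ++ ((v , false) ∷ (v , true) ∷ []) ++ replicate a (v , true)
      ≈⟨ ≈-rel (replicate a (v , false)) (replicate a (v , true)) (cancel v false) ⟩
    replicate a (v , false) ++ replicate a (v , true)
      ≈⟨ replicate-cancel v a ⟩
    []
      ∎

  replicate-power : ∀ v {a b} → a ℕ.+ b ≡ N v → replicate b (v , false) ~ replicate a (v , true)
  replicate-power v {a} {b} a+b≡N = begin
    replicate b (v , false)
      ≡⟨ LP.++-identityʳ _ ⟨
    replicate b (v , false) ++ []
      ≈⟨ ~-++ˡ (replicate b (v , false)) (replicate-cancel v a) ⟨
    replicate b (v , false) ++ replicate a (v , false) ++ replicate a (v , true)
      ≡⟨ LP.++-assoc (replicate b (v , false)) _ _ ⟨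
    (replicate b (v , false) ++ replicate a (v , false)) ++ replicate a (v , true)
      ≡⟨ cong (_++ replicate a (v , true)) (replicate-+ b a (v , false)) ⟨
    replicate (b ℕ.+ a) (v , false) ++ replicate a (v , true)
      ≡⟨ cong (λ m → replicate m (v , false) ++ replicate a (v , true)) (trans (ℕP.+-comm b a) a+b≡N) ⟩
    replicate (N v) (v , false) ++ replicate a (v , true)
      ≈⟨ ~-++ʳ (replicate a (v , true)) (rel⇒~ (power v)) ⟩
    replicate a (v , true)
      ∎

  replicate-complement : ∀ v s {a b} → a ℕ.+ b ≡ N v → replicate b (v , s) ~ replicate a (v , not s)
  replicate-complement v false a+b≡N = replicate-power v a+b≡N
  replicate-complement v true  {a} {b} a+b≡N = ≈-sym (replicate-power v (trans (ℕP.+-comm b a) a+b≡N))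

module Automaton {n : ℕ} (E : Fin n → Fin n → Bool) (N : Fin n → ℕ) where

  update-off : ∀ σ v z {u} → u ≢ v → update E σ v z u ≡ (if E u v then σ u else + 0)
  update-off σ v z {u} u≢v rewrite dec-false (u F.≟ v) u≢v = refl

  δ-gen-accepted : ∀ σ v {σ′} → δ E N (just σ) (gen v) ≡ just σ′ →
                   + 0 ℤ.≤ σ v × σ v ℤ.< half (N v) × update E σ v (σ v ℤ.+ + 1) ≡ σ′
  δ-gen-accepted σ v eq with + 0 ℤ.≤? σ v | σ v ℤ.<? half (N v)
  δ-gen-accepted σ v eq | yes p | yes q = p , q , just-injective eq
  δ-gen-accepted σ v () | yes _ | no _
  δ-gen-accepted σ v () | no _  | _

  δ-inv-accepted : ∀ σ v .{v≢2} {σ′} → δ E N (just σ) (inv v v≢2) ≡ just σ′ →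
                   ℤ.- half (N v) ℤ.< σ v × σ v ℤ.≤ + 0 × update E σ v (σ v ℤ.- + 1) ≡ σ′
  δ-inv-accepted σ v eq with ℤ.- half (N v) ℤ.<? σ v | σ v ℤ.≤? + 0
  δ-inv-accepted σ v eq | yes p | yes q = p , q , just-injective eq
  δ-inv-accepted σ v () | yes _ | no _
  δ-inv-accepted σ v () | no _  | _

  δ-gen-rejected : ∀ σ v → δ E N (just σ) (gen v) ≡ nothing →
                   ¬ (+ 0 ℤ.≤ σ v) ⊎ (+ 0 ℤ.≤ σ v × ¬ (σ v ℤ.< half (N v)))
  δ-gen-rejected σ v eq with + 0 ℤ.≤? σ v | σ v ℤ.<? half (N v)
  δ-gen-rejected σ v () | yes _ | yes _
  δ-gen-rejected σ v _  | yes p | no q = inj₂ (p , q)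
  δ-gen-rejected σ v _  | no p  | _    = inj₁ p

  δ-inv-rejected : ∀ σ v .{v≢2} → δ E N (just σ) (inv v v≢2) ≡ nothing →
                   ¬ (ℤ.- half (N v) ℤ.< σ v) ⊎ ¬ (σ v ℤ.≤ + 0)
  δ-inv-rejected σ v eq with ℤ.- half (N v) ℤ.<? σ v | σ v ℤ.≤? + 0
  δ-inv-rejected σ v () | yes _ | yes _
  δ-inv-rejected σ v _  | yes _ | no q = inj₂ q
  δ-inv-rejected σ v _  | no p  | _    = inj₁ p

  rejection-absorbs : ∀ (w : List (Letter N)) → foldl (δ E N) nothing w ≡ nothing
  rejection-absorbs []      = refl
  rejection-absorbs (_ ∷ w) = rejection-absorbs w

module LowerBound {n : ℕ} (E : Fin n → Fin n → Bool) (N : Fin n → ℕ)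
  (E-sym : ∀ u v → E u v ≡ E v u) (E-irrefl : ∀ v → E v v ≡ false) (2≤N : ∀ v → 2 ≤ N v) where

  open Automaton E N

  Config : Set
  Config = Fin n → Stack

  empty : Config
  empty _ = []

  setStack : Config → Fin n → Stack × ℤ → Config
  setStack x v r w = if does (w F.≟ v) then proj₁ r else (if E w v then x w else raise (proj₂ r) (x w))

  act : Config → FLetter n → Config
  act x (v , b) = setStack x v (mulStack (N v) b (x v))

  actWord : Config → FWord n → Config
  actWord = foldl act

  setStack-at : ∀ x v r → setStack x v r v ≡ proj₁ r
  setStack-at x v r rewrite dec-true (v F.≟ v) refl = refl

  setStack-off : ∀ x v r {w} → w ≢ v → setStack x v r w ≡ (if E w v then x w else raise (proj₂ r) (x w))
  setStack-off x v r {w} w≢v rewrite dec-false (w F.≟ v) w≢v = refl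

  adjacent⇒≢ : ∀ {u v} → E u v ≡ true → u ≢ v
  adjacent⇒≢ {u} Euv refl with () ← trans (sym Euv) (E-irrefl u)

  setStack-adjacent : ∀ x v r {w} → E w v ≡ true → setStack x v r w ≡ x w
  setStack-adjacent x v r {w} Ewv rewrite setStack-off x v r (adjacent⇒≢ Ewv) | Ewv = refl

  setStack-self : ∀ x v → setStack x v (x v , + 0) ≗ x
  setStack-self x v w with w F.≟ v
  ... | yes refl = refl
  ... | no _ with E w v
  ...   | true  = refl
  ...   | false = raise-identity (x w)

  setStack-setStack : ∀ x v l₁ d₁ r →
                      setStack (setStack x v (l₁ , d₁)) v r ≗ setStack x v (proj₁ r , d₁ ℤ.+ proj₂ r)
  setStack-setStack x v l₁ d₁ r w with w F.≟ v
  ... | yes refl = refl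
  ... | no _ with E w v
  ...   | true  = refl
  ...   | false = raise-raise (proj₂ r) d₁ (x w)

  setStack-comm : ∀ x {u v} r s → E u v ≡ true →
                  setStack (setStack x u r) v s ≗ setStack (setStack x v s) u r
  setStack-comm x {u} {v} r s Euv w with w F.≟ u | w F.≟ v
  ... | yes refl | yes refl = ⊥-elim (adjacent⇒≢ Euv refl)
  ... | yes refl | no _ rewrite Euv = refl
  ... | no _ | yes refl rewrite trans (E-sym v u) Euv = refl
  ... | no _ | no _ with E w u | E w v
  ... | true  | true  = refl
  ... | true  | false = refl
  ... | false | true  = refl
  ... | false | false = raise-comm (proj₂ s) (proj₂ r) (x w)

  act-comm : ∀ x {u v} b c → E u v ≡ true → act (act x (u , b)) (v , c) ≗ act (act x (v , c)) (u , b)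
  act-comm x {u} {v} b c Euv w
    rewrite setStack-adjacent x u (mulStack (N u) b (x u)) (trans (E-sym v u) Euv)
          | setStack-adjacent x v (mulStack (N v) c (x v)) Euv
    = setStack-comm x (mulStack (N u) b (x u)) (mulStack (N v) c (x v)) Euv w

  setStack-cong : ∀ {x y} → x ≗ y → ∀ v r → setStack x v r ≗ setStack y v r
  setStack-cong x≗y v r w with w F.≟ v
  ... | yes _ = refl
  ... | no _ with E w v
  ...   | true  = x≗y w
  ...   | false = cong (raise (proj₂ r)) (x≗y w)

  act-cong : ∀ {x y} → x ≗ y → ∀ ℓ → act x ℓ ≗ act y ℓ
  act-cong {x} x≗y (v , b) w =
    trans (cong (λ l → setStack x v (mulStack (N v) b l) w) (x≗y v)) (setStack-cong x≗y v _ w)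

  actWord-cong : ∀ {x y} → x ≗ y → ∀ ws → actWord x ws ≗ actWord y ws
  actWord-cong x≗y []       = x≗y
  actWord-cong x≗y (ℓ ∷ ws) = actWord-cong (act-cong x≗y ℓ) ws

  actWord-map : ∀ x v bs → actWord x (map (v ,_) bs) ≗ setStack x v (runStack (N v) bs (x v))
  actWord-map x v []       = λ w → sym (setStack-self x v w)
  actWord-map x v (b ∷ bs) w = begin
    actWord (setStack x v r) (map (v ,_) bs) w
      ≡⟨ actWord-map (setStack x v r) v bs w ⟩
    setStack (setStack x v r) v (runStack (N v) bs (setStack x v r v)) w
      ≡⟨ cong (λ l → setStack (setStack x v r) v (runStack (N v) bs l) w) (setStack-at x v r) ⟩
    setStack (setStack x v r) v (runStack (N v) bs (proj₁ r)) w
      ≡⟨ setStack-setStack x v (proj₁ r) (proj₂ r) _ w ⟩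
    setStack x v (runStack (N v) (b ∷ bs) (x v)) w
      ∎
    where
    open ≡-Reasoning
    r = mulStack (N v) b (x v)

  ReducedConfig : Config → Set
  ReducedConfig x = ∀ v → Reduced (N v) (x v)

  Reduced-act : ∀ x → ReducedConfig x → ∀ ℓ → ReducedConfig (act x ℓ)
  Reduced-act x red (v , b) w with w F.≟ v
  ... | yes refl = Reduced-mulStack b (x w) (2≤N w) (red w)
  ... | no _ with E w v
  ...   | true  = red w
  ...   | false = Reduced-raise (N w) _ (x w) (red w)

  Reduced-actWord : ∀ x → ReducedConfig x → ∀ ws → ReducedConfig (actWord x ws)
  Reduced-actWord x red []       = red
  Reduced-actWord x red (ℓ ∷ ws) = Reduced-actWord (act x ℓ) (Reduced-act x red ℓ) ws

  actWord-identity : ∀ x v bs → Runs (N v) bs (x v) (x v) (+ 0) → actWord x (map (v ,_) bs) ≗ x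
  actWord-identity x v bs r w =
    trans (actWord-map x v bs w) (trans (cong (λ r → setStack x v r w) (ran r)) (setStack-self x v w))

  actWord-rel : ∀ x → ReducedConfig x → ∀ {l r} → Rel E N l r → actWord x l ≗ actWord x r
  actWord-rel x red (cancel v b) =
    actWord-identity x v (b ∷ not b ∷ []) (runStack-cancel b (x v) (2≤N v) (red v))
  actWord-rel x red (power v) w =
    trans (cong (λ ws → actWord x ws w) (sym (LP.map-replicate (v ,_) (N v) false)))
          (actWord-identity x v (replicate (N v) false) (runStack-power (x v) (2≤N v) (red v)) w)
  actWord-rel x red (comm u v Euv) = act-comm x false false (T⇒≡true Euv)
    where
    T⇒≡true : ∀ {b} → T b → b ≡ true
    T⇒≡true {true} _ = refl

  actWord-resp-≈ : ∀ {w w′} → w ≈⟨ E , N ⟩ w′ → actWord empty w ≗ actWord empty w′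
  actWord-resp-≈ ≈-refl           = λ _ → refl
  actWord-resp-≈ (≈-sym p)        = λ u → sym (actWord-resp-≈ p u)
  actWord-resp-≈ (≈-trans p q)    = λ u → trans (actWord-resp-≈ p u) (actWord-resp-≈ q u)
  actWord-resp-≈ (≈-rel {l = l} {r = r} a b rl) u
    rewrite LP.foldl-++ act empty a (l ++ b) | LP.foldl-++ act empty a (r ++ b)
          | LP.foldl-++ act (actWord empty a) l b | LP.foldl-++ act (actWord empty a) r b
    = actWord-cong (actWord-rel (actWord empty a) (Reduced-actWord empty (λ _ → _) a) rl) b u

  sum-agree-except : ∀ {m} (f g : Fin m → ℕ) v → (∀ w → w ≢ v → f w ≡ g w) →
                     sum f ℕ.+ g v ≡ sum g ℕ.+ f v
  sum-agree-except {suc m} f g v f≡g = begin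
    sum f ℕ.+ g v                            ≡⟨ cong (ℕ._+ g v) (sum-remove f) ⟩
    f v ℕ.+ sum (removeAt f v) ℕ.+ g v
      ≡⟨ cong (λ s → f v ℕ.+ s ℕ.+ g v) (sum-cong-≗ (λ j → f≡g _ (FP.punchInᵢ≢i v j))) ⟩
    f v ℕ.+ sum (removeAt g v) ℕ.+ g v       ≡⟨ xy∙z≈zy∙x (f v) _ (g v) ⟩
    g v ℕ.+ sum (removeAt g v) ℕ.+ f v       ≡⟨ cong (ℕ._+ f v) (sum-remove g) ⟨
    sum g ℕ.+ f v                            ∎
    where open ≡-Reasoning

  totalCost : Config → ℕ
  totalCost x = sum (λ v → cost (N v) (x v))

  totalCost-empty : totalCost empty ≡ 0
  totalCost-empty = sum-replicate-zero n

  totalCost-cong : ∀ {x y} → x ≗ y → totalCost x ≡ totalCost y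
  totalCost-cong x≗y = sum-cong-≗ (λ v → cong (cost (N v)) (x≗y v))

  totalCost-setStack : ∀ x v r →
                       totalCost (setStack x v r) ℕ.+ cost (N v) (x v) ≡ totalCost x ℕ.+ cost (N v) (proj₁ r)
  totalCost-setStack x v r =
    trans (sum-agree-except _ _ v off) (cong (λ l → totalCost x ℕ.+ cost (N v) l) (setStack-at x v r))
    where
    off : ∀ w → w ≢ v → cost (N w) (setStack x v r w) ≡ cost (N w) (x w)
    off w w≢v rewrite setStack-off x v r w≢v with E w v
    ... | true  = refl
    ... | false = cost-raise (N w) _ (x w)

  totalCost-act≤ : ∀ x ℓ → totalCost (act x ℓ) ≤ suc (totalCost x)
  totalCost-act≤ x (v , b) = ℕP.+-cancelʳ-≤ (cost (N v) (x v)) _ _ (begin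
    totalCost (act x (v , b)) ℕ.+ cost (N v) (x v)               ≡⟨ totalCost-setStack x v _ ⟩
    totalCost x ℕ.+ cost (N v) (proj₁ (mulStack (N v) b (x v)))
      ≤⟨ ℕP.+-monoʳ-≤ (totalCost x) (cost-mulStack (N v) b (x v)) ⟩
    totalCost x ℕ.+ suc (cost (N v) (x v))                        ≡⟨ ℕP.+-suc (totalCost x) _ ⟩
    suc (totalCost x) ℕ.+ cost (N v) (x v)                        ∎)
    where open ℕP.≤-Reasoning

  totalCost-actWord≤ : ∀ x ws → totalCost (actWord x ws) ≤ totalCost x ℕ.+ length ws
  totalCost-actWord≤ x []       = ℕP.≤-reflexive (sym (ℕP.+-identityʳ (totalCost x)))
  totalCost-actWord≤ x (ℓ ∷ ws) = begin
    totalCost (actWord (act x ℓ) ws)   ≤⟨ totalCost-actWord≤ (act x ℓ) ws ⟩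
    totalCost (act x ℓ) ℕ.+ length ws  ≤⟨ ℕP.+-monoˡ-≤ (length ws) (totalCost-act≤ x ℓ) ⟩
    suc (totalCost x) ℕ.+ length ws    ≡⟨ ℕP.+-suc (totalCost x) (length ws) ⟨
    totalCost x ℕ.+ length (ℓ ∷ ws)    ∎
    where open ℕP.≤-Reasoning

  record Simulates (σ : Fin n → ℤ) (x : Config) : Set where
    field
      clique : ∀ u v → u ≢ v → σ u ≢ + 0 → σ v ≢ + 0 → E u v ≡ true
      tracks : ∀ u → Tracks (N u) (σ u) (x u)

  simulates-start : Simulates (λ _ → + 0) empty
  simulates-start = record { clique = λ _ _ _ σu≢0 _ → ⊥-elim (σu≢0 refl) ; tracks = λ _ → _ }

  update-support : ∀ σ v z {u} → u ≢ v → update E σ v z u ≢ + 0 → E u v ≡ true × update E σ v z u ≡ σ u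
  update-support σ v z {u} u≢v nz rewrite update-off σ v z u≢v with E u v
  ... | true  = refl , refl
  ... | false = ⊥-elim (nz refl)

  Simulates-update : ∀ {σ x v z r} → Simulates σ x → Advance (N v) (σ v) z (x v) r →
                     Simulates (update E σ v z) (setStack x v r)
  Simulates-update {σ} {x} {v} {z} {r} sim adv = record { clique = clique′ ; tracks = tracks′ }
    where
    open Simulates sim
    open Advance adv

    clique′ : ∀ u w → u ≢ w → update E σ v z u ≢ + 0 → update E σ v z w ≢ + 0 → E u w ≡ true
    clique′ u w u≢w nzu nzw = cases (u F.≟ v) (w F.≟ v)
      where
      cases : Dec (u ≡ v) → Dec (w ≡ v) → E u w ≡ true
      cases (yes refl) (yes refl) = ⊥-elim (u≢w refl)
      cases (yes refl) (no w≢v)   = trans (E-sym u w) (proj₁ (update-support σ v z w≢v nzw))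
      cases (no u≢v)   (yes refl) = proj₁ (update-support σ v z u≢v nzu)
      cases (no u≢v)   (no w≢v)   = clique u w u≢w
        (λ σu≡0 → nzu (trans (proj₂ (update-support σ v z u≢v nzu)) σu≡0))
        (λ σw≡0 → nzw (trans (proj₂ (update-support σ v z w≢v nzw)) σw≡0))

    -- If u had an exposed syllable, the clique condition forces σ v = 0, so v pushed and raised u's stack.
    buried : ∀ u → u ≢ v → E u v ≡ false → Buried (raise (proj₂ r) (x u))
    buried u u≢v Euv with σ u ℤ.≟ + 0 | σ v ℤ.≟ + 0
    ... | yes σu≡0 | _        = Buried-raise (x u) growth≥0 (subst (λ s → Tracks (N u) s (x u)) σu≡0 (tracks u))
    ... | no σu≢0  | yes σv≡0 rewrite growth-new σv≡0 = Tracks-nonzero⇒Buried-raise (x u) σu≢0 (tracks u)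
    ... | no σu≢0  | no σv≢0  with () ← trans (sym (clique u v u≢v σu≢0 σv≢0)) Euv

    tracks′ : ∀ u → Tracks (N u) (update E σ v z u) (setStack x v r u)
    tracks′ u with u F.≟ v
    ... | yes refl = tracks-next
    ... | no u≢v with E u v in Euv
    ...   | true  = tracks u
    ...   | false = buried u u≢v Euv

  totalCost-advance : ∀ {x v z z′ r} → Advance (N v) z z′ (x v) r → totalCost (setStack x v r) ≡ suc (totalCost x)
  totalCost-advance {x} {v} {r = r} adv = ℕP.+-cancelʳ-≡ (cost (N v) (x v)) _ _ (begin
    totalCost (setStack x v r) ℕ.+ cost (N v) (x v)   ≡⟨ totalCost-setStack x v r ⟩
    totalCost x ℕ.+ cost (N v) (proj₁ r)              ≡⟨ cong (totalCost x ℕ.+_) (Advance.cost-suc adv) ⟩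
    totalCost x ℕ.+ suc (cost (N v) (x v))            ≡⟨ ℕP.+-suc (totalCost x) _ ⟩
    suc (totalCost x) ℕ.+ cost (N v) (x v)            ∎)
    where open ≡-Reasoning

  simulate-letter : ∀ {σ σ′ x} ℓ → Simulates σ x → δ E N (just σ) ℓ ≡ just σ′ →
                    Simulates σ′ (act x ⟦ ℓ ⟧ˡ) × totalCost (act x ⟦ ℓ ⟧ˡ) ≡ suc (totalCost x)
  simulate-letter {σ} {x = x} (gen v) sim eq with δ-gen-accepted σ v eq
  ... | 0≤σv , σv<half , refl = Simulates-update sim adv , totalCost-advance adv
    where adv = advance-gen (x v) (2≤N v) (Simulates.tracks sim v) 0≤σv σv<half
  simulate-letter {σ} {x = x} (inv v v≢2) sim eq with δ-inv-accepted σ v {v≢2} eq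
  ... | -half<σv , σv≤0 , refl = Simulates-update sim adv , totalCost-advance adv
    where adv = advance-inv (x v) (2≤N v) (Simulates.tracks sim v) -half<σv σv≤0

  totalCost-accepting : ∀ {σ x} (w : List (Letter N)) → Simulates σ x → T (is-just (foldl (δ E N) (just σ) w)) →
                        totalCost (actWord x ⟦ w ⟧) ≡ totalCost x ℕ.+ length w
  totalCost-accepting {x = x} [] _ _ = sym (ℕP.+-identityʳ (totalCost x))
  totalCost-accepting {σ} {x} (ℓ ∷ w) sim acc with δ E N (just σ) ℓ in eq
  ... | nothing = ⊥-elim (subst (T ∘ is-just) (rejection-absorbs w) acc)
  ... | just σ′ with simulate-letter ℓ sim eq
  ...   | sim′ , cost≡ = begin
    totalCost (actWord (act x ⟦ ℓ ⟧ˡ) ⟦ w ⟧)   ≡⟨ totalCost-accepting w sim′ acc ⟩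
    totalCost (act x ⟦ ℓ ⟧ˡ) ℕ.+ length w      ≡⟨ cong (ℕ._+ length w) cost≡ ⟩
    suc (totalCost x) ℕ.+ length w             ≡⟨ ℕP.+-suc (totalCost x) (length w) ⟨
    totalCost x ℕ.+ length (ℓ ∷ w)             ∎
    where open ≡-Reasoning

  accepted⇒geodesic : ∀ w → Accepts E N w → Geodesic E N w
  accepted⇒geodesic w acc w′ w′≈w = begin
    length w                            ≡⟨ cong (ℕ._+ length w) totalCost-empty ⟨
    totalCost empty ℕ.+ length w         ≡⟨ totalCost-accepting w simulates-start acc ⟨
    totalCost (actWord empty ⟦ w ⟧)     ≡⟨ totalCost-cong (actWord-resp-≈ w′≈w) ⟨
    totalCost (actWord empty ⟦ w′ ⟧)    ≤⟨ totalCost-actWord≤ empty ⟦ w′ ⟧ ⟩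
    totalCost empty ℕ.+ length ⟦ w′ ⟧    ≡⟨ cong₂ ℕ._+_ totalCost-empty (length-⟦⟧ w′) ⟩
    length w′                           ∎
    where open ℕP.≤-Reasoning

module Shortening {n : ℕ} (E : Fin n → Fin n → Bool) (N : Fin n → ℕ) (2≤N : ∀ v → 2 ≤ N v) where

  open Words E N
  open Automaton E N

  Shortenable : List (Letter N) → Set
  Shortenable p = ∃ λ (w₀ : List (Letter N)) → length w₀ < length p × ⟦ w₀ ⟧ ~ ⟦ p ⟧

  Shortenable-++ : ∀ (p s : List (Letter N)) → Shortenable p → Shortenable (p ++ s)
  Shortenable-++ p s (w₀ , shorter , w₀~p) =
      w₀ ++ s
    , subst₂ _<_ (sym (LP.length-++ w₀ {s})) (sym (LP.length-++ p {s})) (ℕP.+-monoˡ-< (length s) shorter)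
    , subst₂ _~_ (sym (⟦⟧-++ w₀ s)) (sym (⟦⟧-++ p s)) (~-++ʳ ⟦ s ⟧ w₀~p)

  length-snoc : ∀ {A : Set} (p : List A) x → length (p ++ x ∷ []) ≡ suc (length p)
  length-snoc p x = trans (LP.length-++ p) (ℕP.+-comm (length p) 1)

  record Block (u : Fin n) (s : Bool) (k : ℕ) (p : List (Letter N)) : Set where
    field
      letter        : Letter N
      letter-is     : ⟦ letter ⟧ˡ ≡ (u , s)
      prefix        : List (Letter N)
      length-prefix : length prefix ℕ.+ k ≡ length p
      equiv         : ⟦ p ⟧ ~ ⟦ prefix ⟧ ++ replicate k (u , s)

  Block-start : ∀ {u s} p ℓ → ⟦ ℓ ⟧ˡ ≡ (u , s) → Block u s 1 (p ++ ℓ ∷ [])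
  Block-start p ℓ refl = record
    { letter = ℓ ; letter-is = refl ; prefix = p
    ; length-prefix = sym (LP.length-++ p)
    ; equiv = ~-reflexive (⟦⟧-++ p (ℓ ∷ [])) }

  shortened : ∀ (q r p : List (Letter N)) ℓ {k} → length q ℕ.+ k ≡ length p → length r ≤ k →
              length (q ++ r) < length (p ++ ℓ ∷ [])
  shortened q r p ℓ {k} q+k≡p r≤k = begin-strict
    length (q ++ r)          ≡⟨ LP.length-++ q ⟩
    length q ℕ.+ length r    ≤⟨ ℕP.+-monoʳ-≤ (length q) r≤k ⟩
    length q ℕ.+ k           ≡⟨ q+k≡p ⟩
    length p                 <⟨ ℕP.n<1+n (length p) ⟩
    suc (length p)           ≡⟨ length-snoc p ℓ ⟨
    length (p ++ ℓ ∷ [])     ∎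
    where open ℕP.≤-Reasoning

  Block-snoc : ∀ {u s k p x} (b : Block u s k p) ℓ → ⟦ ℓ ⟧ˡ ≡ x →
               ⟦ p ++ ℓ ∷ [] ⟧ ~ ⟦ Block.prefix b ⟧ ++ replicate k (u , s) ++ x ∷ []
  Block-snoc {u} {s} {k} {p} {x} b ℓ ℓ-is = begin
    ⟦ p ++ ℓ ∷ [] ⟧                                  ≡⟨ trans (⟦⟧-++ p (ℓ ∷ [])) (cong (λ y → ⟦ p ⟧ ++ y ∷ []) ℓ-is) ⟩
    ⟦ p ⟧ ++ x ∷ []                                  ≈⟨ ~-++ʳ (x ∷ []) equiv ⟩
    (⟦ prefix ⟧ ++ replicate k (u , s)) ++ x ∷ []    ≡⟨ LP.++-assoc ⟦ prefix ⟧ _ _ ⟩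
    ⟦ prefix ⟧ ++ replicate k (u , s) ++ x ∷ []      ∎
    where
    open Block b
    open ~-Reasoning

  Block-extend : ∀ {u s k} p ℓ → ⟦ ℓ ⟧ˡ ≡ (u , s) → Block u s k p → Block u s (suc k) (p ++ ℓ ∷ [])
  Block-extend {u} {s} {k} p ℓ ℓ-is b = record
    { letter = letter ; letter-is = letter-is ; prefix = prefix
    ; length-prefix = trans (ℕP.+-suc (length prefix) k) (trans (cong suc length-prefix) (sym (length-snoc p ℓ)))
    ; equiv = begin
        ⟦ p ++ ℓ ∷ [] ⟧                                    ≈⟨ Block-snoc b ℓ ℓ-is ⟩
        ⟦ prefix ⟧ ++ replicate k (u , s) ++ (u , s) ∷ []  ≡⟨ cong (⟦ prefix ⟧ ++_) (replicate-snoc k (u , s)) ⟨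
        ⟦ prefix ⟧ ++ replicate (suc k) (u , s)            ∎ }
    where
    open Block b
    open ~-Reasoning

  Block-pass : ∀ {u s k} p ℓ → Commute (u , s) ⟦ ℓ ⟧ˡ → Block u s k p → Block u s k (p ++ ℓ ∷ [])
  Block-pass {u} {s} {k} p ℓ c b = record
    { letter = letter ; letter-is = letter-is ; prefix = prefix ++ ℓ ∷ []
    ; length-prefix =
        trans (cong (ℕ._+ k) (length-snoc prefix ℓ)) (trans (cong suc length-prefix) (sym (length-snoc p ℓ)))
    ; equiv = begin
        ⟦ p ++ ℓ ∷ [] ⟧                     ≈⟨ Block-snoc b ℓ refl ⟩
        ⟦ prefix ⟧ ++ block ++ ⟦ ℓ ⟧ˡ ∷ []  ≈⟨ ~-++ˡ ⟦ prefix ⟧ (replicate-commute k c) ⟩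
        ⟦ prefix ⟧ ++ ⟦ ℓ ⟧ˡ ∷ block        ≡⟨ trans (cong (_++ block) (⟦⟧-++ prefix (ℓ ∷ [])))
                                                     (LP.++-assoc ⟦ prefix ⟧ (⟦ ℓ ⟧ˡ ∷ []) block) ⟨
        ⟦ prefix ++ ℓ ∷ [] ⟧ ++ block       ∎ }
    where
    open Block b
    open ~-Reasoning
    block = replicate k (u , s)

  cancel-shortens : ∀ {v s m} p ℓ → Block v s (suc m) p → ⟦ ℓ ⟧ˡ ≡ (v , not s) → Shortenable (p ++ ℓ ∷ [])
  cancel-shortens {v} {s} {m} p ℓ b ℓ-is =
      prefix ++ replicate m letter
    , shortened prefix _ p ℓ length-prefix (ℕP.≤-trans (ℕP.≤-reflexive (LP.length-replicate m)) (ℕP.n≤1+n m))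
    , ≈-sym (begin
      ⟦ p ++ ℓ ∷ [] ⟧
        ≈⟨ Block-snoc b ℓ ℓ-is ⟩
      ⟦ prefix ⟧ ++ replicate (suc m) (v , s) ++ (v , not s) ∷ []
        ≡⟨ cong (λ r → ⟦ prefix ⟧ ++ r ++ (v , not s) ∷ []) (replicate-snoc m (v , s)) ⟩
      ⟦ prefix ⟧ ++ (block ++ (v , s) ∷ []) ++ (v , not s) ∷ []
        ≡⟨ cong (⟦ prefix ⟧ ++_) (LP.++-assoc block _ _) ⟩
      ⟦ prefix ⟧ ++ block ++ (v , s) ∷ (v , not s) ∷ []
        ≈⟨ ~-++ˡ ⟦ prefix ⟧ (~-++ˡ block (rel⇒~ (cancel v s))) ⟩
      ⟦ prefix ⟧ ++ block ++ []
        ≡⟨ cong (⟦ prefix ⟧ ++_) (LP.++-identityʳ block) ⟩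
      ⟦ prefix ⟧ ++ block
        ≡⟨ trans (⟦⟧-++ prefix _) (cong (⟦ prefix ⟧ ++_) ⟦letters⟧) ⟨
      ⟦ prefix ++ replicate m letter ⟧
        ∎)
    where
    open Block b
    open ~-Reasoning
    block = replicate m (v , s)
    ⟦letters⟧ : ⟦ replicate m letter ⟧ ≡ block
    ⟦letters⟧ = trans (⟦⟧-replicate m letter) (cong (replicate m) letter-is)

  power-shortens : ∀ {v s k} p ℓ → Block v s (suc k) p → suc k ≡ N v ℕ./ 2 → ⟦ ℓ ⟧ˡ ≡ (v , s) →
                   ∀ L → ⟦ L ⟧ ≡ replicate (N v ∸ suc (suc k)) (v , not s) → Shortenable (p ++ ℓ ∷ [])
  power-shortens {v} {s} {k} p ℓ b k≡N/2 ℓ-is L ⟦L⟧ =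
      prefix ++ L
    , shortened prefix L p ℓ length-prefix |L|≤1+k
    , ≈-sym (begin
      ⟦ p ++ ℓ ∷ [] ⟧
        ≈⟨ Block-snoc b ℓ ℓ-is ⟩
      ⟦ prefix ⟧ ++ replicate (suc k) (v , s) ++ (v , s) ∷ []
        ≡⟨ cong (⟦ prefix ⟧ ++_) (replicate-snoc (suc k) (v , s)) ⟨
      ⟦ prefix ⟧ ++ replicate (suc (suc k)) (v , s)
        ≈⟨ ~-++ˡ ⟦ prefix ⟧ (replicate-complement v s (ℕP.m∸n+n≡m 2+k≤N)) ⟩
      ⟦ prefix ⟧ ++ replicate a (v , not s)
        ≡⟨ trans (⟦⟧-++ prefix L) (cong (⟦ prefix ⟧ ++_) ⟦L⟧) ⟨
      ⟦ prefix ++ L ⟧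
        ∎)
    where
    open Block b
    open ~-Reasoning
    a = N v ∸ suc (suc k)
    2+k≤N : suc (suc k) ≤ N v
    2+k≤N = ℕP.≤-trans (s≤s (ℕP.m≤n+m (suc k) k)) (j≤m/2⇒j+j≤m (N v) (ℕP.≤-reflexive k≡N/2))
    N≤3+2k : N v ≤ suc (suc k) ℕ.+ suc k
    N≤3+2k = subst (λ h → N v ≤ suc (h ℕ.+ h)) (sym k≡N/2) (m≤1+m/2+m/2 (N v))
    |L|≤1+k : length L ≤ suc k
    |L|≤1+k = subst (_≤ suc k) (trans (sym (LP.length-replicate a)) (trans (cong length (sym ⟦L⟧)) (length-⟦⟧ L)))
                    (ℕP.m≤n+o⇒m∸n≤o (N v) (suc (suc k)) N≤3+2k)

  Witness : Fin n → ℤ → List (Letter N) → Set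
  Witness u (+ zero)  p = ⊤
  Witness u (+ suc k) p = suc k ≤ N u ℕ./ 2 × Block u false (suc k) p
  Witness u -[1+ m ]  p = suc m ≤ N u ℕ./ 2 × Block u true (suc m) p

  Witness-pass : ∀ {u v s} z p ℓ → T (E u v) → ⟦ ℓ ⟧ˡ ≡ (v , s) → Witness u z p → Witness u z (p ++ ℓ ∷ [])
  Witness-pass (+ zero)  _ _ _   _    _         = tt
  Witness-pass (+ suc _) p ℓ Euv ℓ-is (bnd , b) =
    bnd , Block-pass p ℓ (subst (Commute _) (sym ℓ-is) (commute Euv false _)) b
  Witness-pass -[1+ _ ]  p ℓ Euv ℓ-is (bnd , b) =
    bnd , Block-pass p ℓ (subst (Commute _) (sym ℓ-is) (commute Euv true _)) b

  Witness-gen : ∀ {v} z p → Witness v z p → + 0 ℤ.≤ z → z ℤ.< half (N v) →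
                Witness v (z ℤ.+ + 1) (p ++ gen v ∷ [])
  Witness-gen     (+ zero)  p _         _ (ℤ.+<+ lt) = lt , Block-start p (gen _) refl
  Witness-gen {v} (+ suc k) p (_ , b)   _ (ℤ.+<+ lt) rewrite ℕP.+-comm k 1 = lt , Block-extend p (gen v) refl b
  Witness-gen     -[1+ _ ]  _ _         () _

  Witness-inv : ∀ {v} .{v≢2} z p → Witness v z p → ℤ.- half (N v) ℤ.< z → z ℤ.≤ + 0 →
                Witness v (z ℤ.- + 1) (p ++ inv v v≢2 ∷ [])
  Witness-inv           (+ zero)  p _       bnd _ = -h<0⇒1≤h bnd , Block-start p (inv _ _) refl
  Witness-inv           (+ suc _) _ _       _   (ℤ.+≤+ ())
  Witness-inv {v} {v≢2} -[1+ m ]  p (_ , b) bnd _ rewrite ℕP.+-identityʳ m =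
    -h<-[1+m]⇒2+m≤h bnd , Block-extend p (inv v v≢2) refl b

  Witnessed : List (Letter N) → (Fin n → ℤ) → Set
  Witnessed p σ = ∀ u → Witness u (σ u) p

  Witnessed-update : ∀ {p σ v s z} ℓ → ⟦ ℓ ⟧ˡ ≡ (v , s) → Witness v z (p ++ ℓ ∷ []) → Witnessed p σ →
                     Witnessed (p ++ ℓ ∷ []) (update E σ v z)
  Witnessed-update {p} {σ} {v} ℓ ℓ-is wv wit u with u F.≟ v
  ... | yes refl = wv
  ... | no _ with E u v in Euv
  ...   | true  = Witness-pass (σ u) p ℓ (subst T (sym Euv) tt) ℓ-is (wit u)
  ...   | false = tt

  1≤N/2 : ∀ v → 1 ≤ N v ℕ./ 2
  1≤N/2 v = DM.m≥n⇒m/n>0 (2≤N v)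

  -- If N v = 2 there is no letter v⁻¹, but then none is needed.
  inverse-powers : ∀ v k → ∃ λ (L : List (Letter N)) → ⟦ L ⟧ ≡ replicate (N v ∸ suc (suc k)) (v , true)
  inverse-powers v k with N v ℕ.≟ 2
  ... | yes N≡2 rewrite N≡2 | ℕP.0∸n≡0 k = [] , refl
  ... | no N≢2  = replicate _ (inv v N≢2) , ⟦⟧-replicate _ (inv v N≢2)

  reject-gen-high : ∀ {v} z p → Witness v z p → + 0 ℤ.≤ z → ¬ (z ℤ.< half (N v)) →
                    Shortenable (p ++ gen v ∷ [])
  reject-gen-high {v} (+ zero)  p _         _ ≮half = ⊥-elim (≮half (ℤ.+<+ (1≤N/2 v)))
  reject-gen-high {v} (+ suc k) p (bnd , b) _ ≮half =
    power-shortens p (gen v) b (ℕP.≤∧≮⇒≡ bnd (λ lt → ≮half (ℤ.+<+ lt))) refl L ⟦L⟧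
    where
    L = proj₁ (inverse-powers v k)
    ⟦L⟧ = proj₂ (inverse-powers v k)

  reject-gen-negative : ∀ {v} z p → Witness v z p → ¬ (+ 0 ℤ.≤ z) → Shortenable (p ++ gen v ∷ [])
  reject-gen-negative     (+ _)     _ _       0≰z = ⊥-elim (0≰z (ℤ.+≤+ z≤n))
  reject-gen-negative {v} -[1+ _ ]  p (_ , b) _   = cancel-shortens p (gen v) b refl

  reject-inv-low : ∀ {v} .{v≢2} z p → Witness v z p → ¬ (ℤ.- half (N v) ℤ.< z) →
                   Shortenable (p ++ inv v v≢2 ∷ [])
  reject-inv-low {v} (+ zero)  _ _ ≮z = ⊥-elim (≮z (ℤP.neg-mono-< (ℤ.+<+ (1≤N/2 v))))
  reject-inv-low     (+ suc _) _ _ ≮z = ⊥-elim (≮z (ℤP.≤-<-trans ℤP.neg-≤-pos (ℤ.+<+ (s≤s z≤n))))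
  reject-inv-low {v} {v≢2} -[1+ m ] p (bnd , b) ≮z =
    power-shortens p (inv v v≢2) b (ℕP.≤∧≮⇒≡ bnd (λ lt → ≮z (ℤP.neg-mono-< (ℤ.+<+ lt)))) refl
      (replicate (N v ∸ suc (suc m)) (gen v)) (⟦⟧-replicate _ (gen v))

  reject-inv-positive : ∀ {v} .{v≢2} z p → Witness v z p → ¬ (z ℤ.≤ + 0) → Shortenable (p ++ inv v v≢2 ∷ [])
  reject-inv-positive         (+ zero)  _ _       z≰0 = ⊥-elim (z≰0 (ℤ.+≤+ z≤n))
  reject-inv-positive {v} {v≢2} (+ suc _) p (_ , b) _ = cancel-shortens p (inv v v≢2) b refl
  reject-inv-positive         -[1+ _ ]  _ _       z≰0 = ⊥-elim (z≰0 ℤ.-≤+)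

  step-accepts : ∀ {p σ σ′} ℓ → Witnessed p σ → δ E N (just σ) ℓ ≡ just σ′ → Witnessed (p ++ ℓ ∷ []) σ′
  step-accepts {p} {σ} (gen v) wit eq with δ-gen-accepted σ v eq
  ... | 0≤σv , σv<half , refl = Witnessed-update (gen v) refl (Witness-gen (σ v) p (wit v) 0≤σv σv<half) wit
  step-accepts {p} {σ} (inv v v≢2) wit eq with δ-inv-accepted σ v {v≢2} eq
  ... | -half<σv , σv≤0 , refl = Witnessed-update (inv v v≢2) refl (Witness-inv (σ v) p (wit v) -half<σv σv≤0) wit

  step-rejects : ∀ {p σ} ℓ → Witnessed p σ → δ E N (just σ) ℓ ≡ nothing → Shortenable (p ++ ℓ ∷ [])
  step-rejects {p} {σ} (gen v) wit eq with δ-gen-rejected σ v eq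
  ... | inj₁ 0≰σv            = reject-gen-negative (σ v) p (wit v) 0≰σv
  ... | inj₂ (0≤σv , ≮half)  = reject-gen-high (σ v) p (wit v) 0≤σv ≮half
  step-rejects {p} {σ} (inv v v≢2) wit eq with δ-inv-rejected σ v {v≢2} eq
  ... | inj₁ ≮σv = reject-inv-low (σ v) p (wit v) ≮σv
  ... | inj₂ σv≰0 = reject-inv-positive (σ v) p (wit v) σv≰0

  rejected⇒shortenable : ∀ p σ → Witnessed p σ → ∀ w → foldl (δ E N) (just σ) w ≡ nothing →
                         Shortenable (p ++ w)
  rejected⇒shortenable p σ wit []      ()
  rejected⇒shortenable p σ wit (ℓ ∷ w) rej with δ E N (just σ) ℓ in eq
  ... | just σ′ = subst Shortenable (LP.++-assoc p (ℓ ∷ []) w)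
                    (rejected⇒shortenable (p ++ ℓ ∷ []) σ′ (step-accepts ℓ wit eq) w rej)
  ... | nothing = subst Shortenable (LP.++-assoc p (ℓ ∷ []) w)
                    (Shortenable-++ (p ++ ℓ ∷ []) w (step-rejects ℓ wit eq))

  geodesic⇒accepted : ∀ w → Geodesic E N w → Accepts E N w
  geodesic⇒accepted w geo with foldl (δ E N) start w in eq
  ... | just _  = tt
  ... | nothing with rejected⇒shortenable [] (λ _ → + 0) (λ _ → tt) w eq
  ...   | w₀ , shorter , w₀~w = ⊥-elim (ℕP.<⇒≱ shorter (geo w₀ w₀~w))

theorem4p9 : (n : ℕ) (E : Fin n → Fin n → Bool) (N : Fin n → ℕ) →
    (∀ u v → E u v ≡ E v u) → (∀ v → E v v ≡ false) → (∀ v → 2 ≤ N v) →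
    (w : List (Letter N)) → (Accepts E N w → Geodesic E N w) × (Geodesic E N w → Accepts E N w)
theorem4p9 n E N E-sym E-irrefl 2≤N w =
  LowerBound.accepted⇒geodesic E N E-sym E-irrefl 2≤N w , Shortening.geodesic⇒accepted E N 2≤N w
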